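{- Let $n\ge 1$ and let ${\cal OCT}_n$ be the set of order-preserving full contractions of $X_n=\{1,\dots,n\}$. For integers $1\le m\le p\le n$, the number of $\alpha\in{\cal OCT}_n$ with $h(\alpha)=p$ and $f(\alpha)=m$ is $(n-p+1)\binom{n-m-1}{n-p-1}$.
   Context: Full transformations are maps $\alpha:X_n\to X_n$, written $x\mapsto x\alpha$. Order-preserving: $x\le y\Rightarrow x\alpha\le y\alpha$. Contraction: $|x\alpha-y\alpha|\le|x-y|$ for all $x,y$. $h(\alpha)=|\mathrm{Im}\,\alpha|$, $f(\alpha)=|\{x:x\alpha=x\}|$. Binomial coefficients $\binom{a}{b}$ with $a\ge -1$ are $0$ if $b<0$ or $b>a$, except $\binom{ -1}{ -1}=1$. -}

module Defs where

open import Data.Nat using (ℕ; zero; suc; _+_; _*_; _∸_; _≤_; _≤ᵇ_)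
open import Data.Nat.Combinatorics using (_C_)
open import Data.Integer using (ℤ; +_; -[1+_])
open import Data.Fin using (Fin; toℕ)
open import Data.Fin.Properties using (any?; all?)
open import Data.List using (List; []; _∷_; map; concatMap; length; filter)
open import Data.Product using (_×_; ∃)
open import Relation.Nullary using (Dec; ¬_)
open import Relation.Binary.PropositionalEquality using (_≡_)

-- X_n = {1,…,n} is represented by Fin n = {0,…,n-1} (order and distances shifted by 1).
-- A full transformation of X_n is a function Fin n → Fin n, x ↦ x α written α x.
Transformation : ℕ → Set
Transformation n = Fin n → Fin n

dist : ℕ → ℕ → ℕ
dist a b = (a ∸ b) + (b ∸ a)

OrderPreserving : ∀ {n} → Transformation n → Set
OrderPreserving {n} α = (x y : Fin n) → toℕ x ≤ toℕ y → toℕ (α x) ≤ toℕ (α y)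

Contraction : ∀ {n} → Transformation n → Set
Contraction {n} α = (x y : Fin n) → dist (toℕ (α x)) (toℕ (α y)) ≤ dist (toℕ x) (toℕ y)

InOCT : ∀ {n} → Transformation n → Set
InOCT α = OrderPreserving α × Contraction α

countFin : ∀ {n} (P : Fin n → Set) → ((x : Fin n) → Dec (P x)) → ℕ
countFin {n} P P? = length (filter P? (Data.List.allFin n))
  where import Data.List

h : ∀ {n} → Transformation n → ℕ
h {n} α = countFin (λ y → ∃ λ x → α x ≡ y) (λ y → any? (λ x → α x Data.Fin.≟ y))
  where import Data.Fin

f : ∀ {n} → Transformation n → ℕ
f {n} α = countFin (λ x → α x ≡ x) (λ x → α x Data.Fin.≟ x)
  where import Data.Fin

-- the list of all full transformations of X_n (every function Fin n → Fin n, up to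
-- pointwise equality, occurs exactly once)
allVecFun : (k n : ℕ) → List (Fin k → Fin n)
allVecFun zero n = (λ ()) ∷ []
allVecFun (suc k) n =
  concatMap (λ (g : Fin k → Fin n) → map (λ (y : Fin n) → cons y g) (Data.List.allFin n)) (allVecFun k n)
  where
  import Data.List
  cons : Fin n → (Fin k → Fin n) → Fin (suc k) → Fin n
  cons y g Fin.zero = y
  cons y g (Fin.suc i) = g i

allTransformations : (n : ℕ) → List (Transformation n)
allTransformations n = allVecFun n n

countTrans : ∀ n (P : Transformation n → Set) → ((α : Transformation n) → Dec (P α)) → ℕ
countTrans n P P? = length (filter P? (allTransformations n))

-- binomial coefficient with integer arguments a ≥ -1 as in the paper:
-- 0 if b < 0 or b > a, except binom(-1,-1) = 1.
binomℤ : ℤ → ℤ → ℕ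
binomℤ (+ a) (+ b) = a C b
binomℤ (+ a) -[1+ _ ] = 0
binomℤ -[1+ zero ] -[1+ zero ] = 1
binomℤ -[1+ _ ] _ = 0

inOCT? : ∀ {n} (α : Transformation n) → Dec (InOCT α)
inOCT? {n} α = (all? λ x → all? λ y → Data.Nat._≤?_ (toℕ x) (toℕ y) →-dec
                  Data.Nat._≤?_ (toℕ (α x)) (toℕ (α y)))
         ×-dec (all? λ x → all? λ y → Data.Nat._≤?_
                  (dist (toℕ (α x)) (toℕ (α y))) (dist (toℕ x) (toℕ y)))
  where
  import Data.Nat
  open import Relation.Nullary.Decidable using (_×-dec_; _→-dec_)

countOCT : (n p m : ℕ) → ℕ
countOCT n p m = countTrans n (λ α → InOCT α × h α ≡ p × f α ≡ m)
  (λ α → inOCT? α ×-dec (h α Data.Nat.≟ p) ×-dec (f α Data.Nat.≟ m))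
  where
  import Data.Nat
  open import Relation.Nullary.Decidable using (_×-dec_)

module Submission where

-- Write n = k + 1 and X_n = {0, …, k}.  A map α : X_n → X_n is an
-- order-preserving contraction iff every step α(x+1) - α(x) is 0 (flat) or
-- 1 (up), so α is a walk: a first value a followed by k flat or up steps.
-- Its image is the interval [a, a + #up], hence h(α) = p iff #flat = n - p.
-- The difference α(x) - x starts at a and drops by one at each flat step, so
-- whether a step creates a fixed point depends only on the current gap to
-- the diagonal (Gap, gap).  The number W k γ z m of step sequences of length
-- k with z flat steps meeting the diagonal m times from gap γ has an explicit
-- binomial form, which satisfies the one-step recursion W-step by Pascal's
-- rule.
--
-- Summing W over the first value
-- gives (n - p + 1) · C(n - m - 1, n - p - 1) (sum-closed), which is the
-- theorem corollary2p4.

open import Defs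
open import Data.Nat using (ℕ; zero; suc; _+_; _*_; _∸_; _≤_; _<_; z≤n; s≤s; s≤s⁻¹; z<s; _≤?_; _<?_; _≟_)
open import Data.Nat.Properties
open import Data.Nat.Combinatorics using (_C_; nCk+nC[k+1]≡[n+1]C[k+1]; k>n⇒nCk≡0)
open import Algebra.Properties.CommutativeSemigroup +-commutativeSemigroup using (interchange)
open import Data.Fin using (Fin; toℕ) renaming (zero to fz; suc to fs)
open import Data.Fin.Properties using (toℕ-injective; toℕ<n; any?)
import Data.Fin as Fin
open import Data.List using (List; []; _∷_; _++_; map; concatMap; length; filter; tabulate; allFin)
open import Data.Product using (_×_; _,_; proj₁; proj₂; ∃)
open import Data.Sum using (_⊎_; inj₁; inj₂)
open import Data.Unit using (⊤; tt)
open import Data.Bool using (true; false)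
open import Data.Empty using (⊥-elim)
open import Relation.Nullary using (Dec; yes; no; _because_; ¬_)
open import Relation.Nullary.Decidable using (_×-dec_; _⊎-dec_)
open import Relation.Unary using (Decidable)
open import Relation.Binary.PropositionalEquality
open import Function using (_∘_; id)

⟦_⟧ : {P : Set} → Dec P → ℕ
⟦ true  because _ ⟧ = 1
⟦ false because _ ⟧ = 0

⟦⟧-yes : {P : Set} (d : Dec P) → P → ⟦ d ⟧ ≡ 1
⟦⟧-yes (yes _) _ = refl
⟦⟧-yes (no ¬p) p = ⊥-elim (¬p p)

⟦⟧-no : {P : Set} (d : Dec P) → ¬ P → ⟦ d ⟧ ≡ 0
⟦⟧-no (yes p) ¬p = ⊥-elim (¬p p)
⟦⟧-no (no _) _ = refl

⟦⟧-cong : {P Q : Set} (d : Dec P) (e : Dec Q) → (P → Q) → (Q → P) → ⟦ d ⟧ ≡ ⟦ e ⟧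
⟦⟧-cong (yes p) e to from = sym (⟦⟧-yes e (to p))
⟦⟧-cong (no ¬p) e to from = sym (⟦⟧-no e (¬p ∘ from))

-- The Kronecker delta, by recursion so that δ (suc a) (suc b) = δ a b holds
-- definitionally.
δ : ℕ → ℕ → ℕ
δ zero    zero    = 1
δ zero    (suc b) = 0
δ (suc a) zero    = 0
δ (suc a) (suc b) = δ a b

δ-refl : ∀ a → δ a a ≡ 1
δ-refl zero    = refl
δ-refl (suc a) = δ-refl a

δ-≢ : ∀ {a b} → a ≢ b → δ a b ≡ 0
δ-≢ {zero}  {zero}  a≢b = ⊥-elim (a≢b refl)
δ-≢ {zero}  {suc b} a≢b = refl
δ-≢ {suc a} {zero}  a≢b = refl
δ-≢ {suc a} {suc b} a≢b = δ-≢ (a≢b ∘ cong suc)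

δ≤1 : ∀ a b → δ a b ≤ 1
δ≤1 zero    zero    = ≤-refl
δ≤1 zero    (suc b) = z≤n
δ≤1 (suc a) zero    = z≤n
δ≤1 (suc a) (suc b) = δ≤1 a b

⟦⟧-Fin≡ : ∀ {n} {i j : Fin n} (d : Dec (i ≡ j)) → ⟦ d ⟧ ≡ δ (toℕ i) (toℕ j)
⟦⟧-Fin≡ {i = i} (yes refl) = sym (δ-refl (toℕ i))
⟦⟧-Fin≡ (no i≢j)   = sym (δ-≢ (i≢j ∘ toℕ-injective))

-- lower c F z = F (z ∸ c) if c ≤ z, and 0 otherwise.  It is what remains of
-- a count with target value z once a contribution c has been accounted for.
lower : ℕ → (ℕ → ℕ) → ℕ → ℕ
lower zero    F z       = F z
lower (suc c) F zero    = 0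
lower (suc c) F (suc z) = lower c F z

lower-cong : ∀ c {F G : ℕ → ℕ} z → (∀ x → F x ≡ G x) → lower c F z ≡ lower c G z
lower-cong zero    z       F≗G = F≗G z
lower-cong (suc c) zero    F≗G = refl
lower-cong (suc c) (suc z) F≗G = lower-cong c z F≗G

lower-+ : ∀ c (F G : ℕ → ℕ) z → lower c (λ x → F x + G x) z ≡ lower c F z + lower c G z
lower-+ zero    F G z       = refl
lower-+ (suc c) F G zero    = refl
lower-+ (suc c) F G (suc z) = lower-+ c F G z

lower-vanish : ∀ c (F : ℕ → ℕ) z → (c ≤ z → F (z ∸ c) ≡ 0) → lower c F z ≡ 0
lower-vanish zero    F z       F≡0 = F≡0 z≤n
lower-vanish (suc c) F zero    F≡0 = refl
lower-vanish (suc c) F (suc z) F≡0 = lower-vanish c F z (F≡0 ∘ s≤s)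

private variable
  A E : Set

sumL : List A → (A → ℕ) → ℕ
sumL []       F = 0
sumL (x ∷ xs) F = F x + sumL xs F

count : {P : A → Set} → Decidable P → List A → ℕ
count P? xs = sumL xs (λ x → ⟦ P? x ⟧)


sumL-cong : ∀ (xs : List A) {F G : A → ℕ} → (∀ x → F x ≡ G x) → sumL xs F ≡ sumL xs G
sumL-cong []       F≗G = refl
sumL-cong (x ∷ xs) F≗G = cong₂ _+_ (F≗G x) (sumL-cong xs F≗G)

sumL-++ : ∀ (xs ys : List A) F → sumL (xs ++ ys) F ≡ sumL xs F + sumL ys F
sumL-++ []       ys F = refl
sumL-++ (x ∷ xs) ys F = trans (cong (F x +_) (sumL-++ xs ys F)) (sym (+-assoc (F x) _ _))

sumL-+ : ∀ (xs : List A) F G → sumL xs (λ x → F x + G x) ≡ sumL xs F + sumL xs G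
sumL-+ []       F G = refl
sumL-+ (x ∷ xs) F G = trans (cong (F x + G x +_) (sumL-+ xs F G)) (interchange (F x) (G x) _ _)

sumL-zero : ∀ (xs : List A) → sumL xs (λ _ → 0) ≡ 0
sumL-zero []       = refl
sumL-zero (x ∷ xs) = sumL-zero xs

sumL-comm : (xs : List A) (ys : List E) (F : A → E → ℕ) →
  sumL xs (λ x → sumL ys (F x)) ≡ sumL ys (λ y → sumL xs (λ x → F x y))
sumL-comm []       ys F = sym (sumL-zero ys)
sumL-comm (x ∷ xs) ys F = trans (cong (sumL ys (F x) +_) (sumL-comm xs ys F))
                                (sym (sumL-+ ys (F x) (λ y → sumL xs (λ x' → F x' y))))

sumL-concatMap : ∀ (f : A → List E) xs G →
  sumL (concatMap f xs) G ≡ sumL xs (λ x → sumL (f x) G)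
sumL-concatMap f []       G = refl
sumL-concatMap f (x ∷ xs) G =
  trans (sumL-++ (f x) (concatMap f xs) G) (cong (sumL (f x) G +_) (sumL-concatMap f xs G))

sumL-map : ∀ (f : A → E) xs G → sumL (map f xs) G ≡ sumL xs (G ∘ f)
sumL-map f []       G = refl
sumL-map f (x ∷ xs) G = cong (G (f x) +_) (sumL-map f xs G)

count-length : ∀ {P : A → Set} (P? : Decidable P) xs → length (filter P? xs) ≡ count P? xs
count-length P? []       = refl
count-length P? (x ∷ xs) with P? x
... | yes _ = cong suc (count-length P? xs)
... | no  _ = count-length P? xs

count-cong : ∀ {P Q : A → Set} (P? : Decidable P) (Q? : Decidable Q) →
  (∀ x → P x → Q x) → (∀ x → Q x → P x) → ∀ xs → count P? xs ≡ count Q? xs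
count-cong P? Q? to from xs = sumL-cong xs (λ x → ⟦⟧-cong (P? x) (Q? x) (to x) (from x))

count-none : ∀ {P : A → Set} (P? : Decidable P) → (∀ x → ¬ P x) → ∀ xs → count P? xs ≡ 0
count-none P? none []       = refl
count-none P? none (x ∷ xs) = cong₂ _+_ (⟦⟧-no (P? x) (none x)) (count-none P? none xs)

count-const× : ∀ {C : Set} {P : A → Set} (C? : Dec C) (P? : Decidable P) xs →
  count (λ x → C? ×-dec P? x) xs ≡ ⟦ C? ⟧ * count P? xs
count-const× (yes c) P? xs =
  trans (count-cong (λ x → yes c ×-dec P? x) P? (λ _ → proj₂) (λ _ p → c , p) xs) (sym (+-identityʳ _))
count-const× (no ¬c) P? xs = count-none (λ x → no ¬c ×-dec P? x) (λ _ → ¬c ∘ proj₁) xs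

count-lower : ∀ c z (F : A → ℕ) {R : A → Set} (R? : Decidable R) xs →
  count (λ x → (c + F x ≟ z) ×-dec R? x) xs
    ≡ lower c (λ z' → count (λ x → (F x ≟ z') ×-dec R? x) xs) z
count-lower zero    z       F R? xs = refl
count-lower (suc c) zero    F R? xs = count-none (λ x → (suc c + F x ≟ zero) ×-dec R? x) (λ { _ (() , _) }) xs
count-lower (suc c) (suc z) F R? xs =
  trans (count-cong _ _ (λ { _ (e , r) → suc-injective e , r }) (λ { _ (e , r) → cong suc e , r }) xs)
        (count-lower c z F R? xs)

sumN : ℕ → (ℕ → ℕ) → ℕ
sumN zero    G = 0
sumN (suc k) G = G 0 + sumN k (G ∘ suc)

sumN-cong : ∀ k {F G : ℕ → ℕ} → (∀ j → F j ≡ G j) → sumN k F ≡ sumN k G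
sumN-cong zero    F≗G = refl
sumN-cong (suc k) F≗G = cong₂ _+_ (F≗G 0) (sumN-cong k (F≗G ∘ suc))

sumN-zero : ∀ k → sumN k (λ _ → 0) ≡ 0
sumN-zero zero    = refl
sumN-zero (suc k) = sumN-zero k

sumN-+ : ∀ k (F G : ℕ → ℕ) → sumN k (λ j → F j + G j) ≡ sumN k F + sumN k G
sumN-+ zero    F G = refl
sumN-+ (suc k) F G = trans (cong (F 0 + G 0 +_) (sumN-+ k (F ∘ suc) (G ∘ suc))) (interchange (F 0) (G 0) _ _)

sumL-allFin : ∀ N (F : Fin N → ℕ) (G : ℕ → ℕ) → (∀ i → F i ≡ G (toℕ i)) → sumL (allFin N) F ≡ sumN N G
sumL-allFin N = sumL-tabulate N id
  where
  sumL-tabulate : ∀ k (t : Fin k → A) (F : A → ℕ) G → (∀ i → F (t i) ≡ G (toℕ i)) →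
    sumL (tabulate t) F ≡ sumN k G
  sumL-tabulate zero    t F G F≗G = refl
  sumL-tabulate (suc k) t F G F≗G = cong₂ _+_ (F≗G fz) (sumL-tabulate k (t ∘ fs) F (G ∘ suc) (F≗G ∘ fs))

sumN-δ : ∀ k c X → sumN k (λ j → δ j c * X) ≡ ⟦ c <? k ⟧ * X
sumN-δ zero    c       X = refl
sumN-δ (suc k) zero    X = begin
  X + 0 + sumN k (λ _ → 0)  ≡⟨ cong (X + 0 +_) (sumN-zero k) ⟩
  X + 0 + 0                 ≡⟨ +-identityʳ _ ⟩
  X + 0                     ≡⟨ cong (_* X) (⟦⟧-yes (0 <? suc k) z<s) ⟨
  ⟦ 0 <? suc k ⟧ * X        ∎
  where open ≡-Reasoning
sumN-δ (suc k) (suc c) X = begin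
  sumN k (λ j → δ j c * X)  ≡⟨ sumN-δ k c X ⟩
  ⟦ c <? k ⟧ * X            ≡⟨ cong (_* X) (⟦⟧-cong (c <? k) (suc c <? suc k) s≤s s≤s⁻¹) ⟩
  ⟦ suc c <? suc k ⟧ * X    ∎
  where open ≡-Reasoning

sumN-interval : ∀ k lo len → lo + len < k → sumN k (λ j → ⟦ (lo ≤? j) ×-dec (j ≤? lo + len) ⟧) ≡ suc len
sumN-interval (suc k) zero zero _ = cong₂ _+_ (⟦⟧-yes ((0 ≤? 0) ×-dec (0 ≤? 0)) (z≤n , z≤n))
  (trans (sumN-cong k (λ j → ⟦⟧-no ((0 ≤? suc j) ×-dec (suc j ≤? 0)) λ ())) (sumN-zero k))
sumN-interval (suc k) zero (suc len) (s≤s len<k) = cong₂ _+_ (⟦⟧-yes ((0 ≤? 0) ×-dec (0 ≤? suc len)) (z≤n , z≤n))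
  (trans (sumN-cong k (λ j → ⟦⟧-cong ((0 ≤? suc j) ×-dec (suc j ≤? suc len)) ((0 ≤? j) ×-dec (j ≤? len))
                                     (λ (_ , j≤len) → z≤n , s≤s⁻¹ j≤len) (λ (_ , j≤len) → z≤n , s≤s j≤len)))
         (sumN-interval k zero len len<k))
sumN-interval (suc k) (suc lo) len (s≤s lo+len<k) = cong₂ _+_ (⟦⟧-no ((suc lo ≤? 0) ×-dec (0 ≤? suc lo + len)) λ ())
  (trans (sumN-cong k (λ j → ⟦⟧-cong ((suc lo ≤? suc j) ×-dec (suc j ≤? suc lo + len)) ((lo ≤? j) ×-dec (j ≤? lo + len))
                                     (λ (a , b) → s≤s⁻¹ a , s≤s⁻¹ b) (λ (a , b) → s≤s a , s≤s b)))
         (sumN-interval k lo len lo+len<k))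

sumN-lower : ∀ k t X → t < k → sumN k (λ j → lower j (λ _ → X) t) ≡ suc t * X
sumN-lower (suc k) zero    X _ = cong (X +_) (sumN-zero k)
sumN-lower (suc k) (suc t) X (s≤s t<k) = cong (X +_) (sumN-lower k t X t<k)

-- B k m z = C(k-1-m, z) if m < k, and 0 otherwise: the number of ways of
-- placing z flat steps among the k-1-m steps that follow m+1 prescribed ones.
B : ℕ → ℕ → ℕ → ℕ
B zero    m       z = 0
B (suc k) zero    z = k C z
B (suc k) (suc m) z = B k m z

B-pascal : ∀ k m z → B (suc k) m (suc z) ≡ B k m z + B k m (suc z)
B-pascal zero    zero    z = refl
B-pascal (suc k) zero    z = sym (nCk+nC[k+1]≡[n+1]C[k+1] k z)
B-pascal zero    (suc m) z = refl
B-pascal (suc k) (suc m) z = B-pascal k m z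

B-pascal₀ : ∀ k m → B (suc k) m 0 ≡ δ m k + B k m 0
B-pascal₀ zero    zero    = refl
B-pascal₀ (suc k) zero    = refl
B-pascal₀ zero    (suc m) = refl
B-pascal₀ (suc k) (suc m) = B-pascal₀ k m

B-vanish : ∀ k m z → k ≤ z → B k m z ≡ 0
B-vanish zero    m       z k≤z = refl
B-vanish (suc k) zero    z k<z = k>n⇒nCk≡0 k<z
B-vanish (suc k) (suc m) z k<z = B-vanish k m z (<⇒≤ k<z)

B-closed : ∀ k m z → m < k → B k m z ≡ (k ∸ suc m) C z
B-closed (suc k) zero    z _         = refl
B-closed (suc k) (suc m) z (s≤s m<k) = B-closed k m z m<k

-- A walk that has just taken value u and is about to visit position s is
-- classified by the sign of u + 1 - s:
--   behind   if u + 1 < s (it can never again meet the diagonal),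
--   level    if u + 1 = s (an up-step lands on the diagonal),
--   ahead j  if u = s + j (j + 1 flat steps bring it to the diagonal).
data Gap : Set where
  behind level : Gap
  ahead        : ℕ → Gap

gap : (s u : ℕ) → Gap
gap zero          u       = ahead u
gap (suc s)       (suc u) = gap s u
gap (suc zero)    zero    = level
gap (suc (suc s)) zero    = behind

-- A flat step decreases the gap; it lands on the diagonal exactly from ahead 0,
-- and an up-step (which keeps the gap) exactly from level.
flatGap : Gap → Gap
flatGap behind            = behind
flatGap level             = behind
flatGap (ahead zero)      = level
flatGap (ahead (suc j))   = ahead j

flatFix upFix : Gap → ℕ
flatFix (ahead zero) = 1
flatFix _            = 0
upFix level = 1
upFix _     = 0

gap-flatGap : ∀ s u → flatGap (gap s u) ≡ gap (suc s) u
gap-flatGap zero          zero    = refl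
gap-flatGap zero          (suc u) = refl
gap-flatGap (suc zero)    zero    = refl
gap-flatGap (suc (suc s)) zero    = refl
gap-flatGap (suc s)       (suc u) = gap-flatGap s u

gap-flatFix : ∀ s u → flatFix (gap s u) ≡ δ u s
gap-flatFix zero          zero    = refl
gap-flatFix zero          (suc u) = refl
gap-flatFix (suc zero)    zero    = refl
gap-flatFix (suc (suc s)) zero    = refl
gap-flatFix (suc s)       (suc u) = gap-flatFix s u

gap-upFix : ∀ s u → upFix (gap s u) ≡ δ (suc u) s
gap-upFix zero          u       = refl
gap-upFix (suc zero)    zero    = refl
gap-upFix (suc (suc s)) zero    = refl
gap-upFix (suc s)       (suc u) = gap-upFix s u

gap-ahead : ∀ s j → gap s (s + j) ≡ ahead j
gap-ahead zero    j = refl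
gap-ahead (suc s) j = gap-ahead s j

-- W k γ z m: the number of 0/1 step sequences of length k with z flat steps
-- which, started from gap γ, meet the diagonal exactly m times and end on or
-- below it.  The last condition is automatic for the walks counted in
-- walkCount-closed, whose last entry sits at the largest position.
W : ℕ → Gap → ℕ → ℕ → ℕ
W k behind    z       zero    = k C z
W k behind    z       (suc m) = 0
W k level     zero    m       = δ m k
W k level     (suc z) m       = B k m z
W k (ahead j) zero    m       = 0
W k (ahead j) (suc z) zero    = 0
W k (ahead j) (suc z) (suc m) = lower j (λ _ → B k m z) z

W-step : ∀ k γ z m →
  W (suc k) γ z m ≡ lower 1 (λ z' → lower (flatFix γ) (W k (flatGap γ) z') m) z
                  + lower (upFix γ) (W k γ z) m
W-step k behind          zero          zero    = refl
W-step k behind          zero          (suc m) = refl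
W-step k behind          (suc z)       zero    = sym (nCk+nC[k+1]≡[n+1]C[k+1] k z)
W-step k behind          (suc z)       (suc m) = refl
W-step k level           zero          zero    = refl
W-step k level           zero          (suc m) = refl
W-step k level           (suc z)       zero    = sym (+-identityʳ _)
W-step k level           (suc z)       (suc m) = refl
W-step k (ahead zero)    zero          m       = refl
W-step k (ahead zero)    (suc z)       zero    = refl
W-step k (ahead zero)    (suc zero)    (suc m) = B-pascal₀ k m
W-step k (ahead zero)    (suc (suc z)) (suc m) = B-pascal k m z
W-step k (ahead (suc j)) zero          m       = refl
W-step k (ahead (suc j)) (suc zero)    zero    = refl
W-step k (ahead (suc j)) (suc (suc z)) zero    = refl
W-step k (ahead (suc j)) (suc zero)    (suc m) = refl
W-step k (ahead (suc j)) (suc (suc z)) (suc m) =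
  trans (lower-cong j z (λ _ → B-pascal k m z)) (lower-+ j (λ _ → B k m z) (λ _ → B k m (suc z)) z)

-- A walk more than k steps ahead of the diagonal cannot come back within k steps.
W-unreachable : ∀ k z m → W k (ahead k) z m ≡ 0
W-unreachable k zero    m       = refl
W-unreachable k (suc z) zero    = refl
W-unreachable k (suc z) (suc m) = lower-vanish k (λ _ → B k m z) z (B-vanish k m z)

W-below : ∀ s u → u < s → ∀ z m → W 0 (gap s u) z m ≡ W 0 behind z m
W-below (suc zero)    zero    _         zero    zero    = refl
W-below (suc zero)    zero    _         zero    (suc m) = refl
W-below (suc zero)    zero    _         (suc z) zero    = refl
W-below (suc zero)    zero    _         (suc z) (suc m) = refl
W-below (suc (suc s)) zero    _         z       m       = refl
W-below (suc s)       (suc u) (s≤s u<s) z       m       = W-below s u u<s z m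

Step : ℕ → ℕ → Set
Step u v = v ≡ u ⊎ v ≡ suc u

step? : ∀ u v → Dec (Step u v)
step? u v = (v ≟ u) ⊎-dec (v ≟ suc u)

step-bounds : ∀ {u v} → Step u v → u ≤ v × v ≤ suc u
step-bounds (inj₁ refl) = ≤-refl , n≤1+n _
step-bounds (inj₂ refl) = n≤1+n _ , ≤-refl

step-up : ∀ {u v} → Step u v → v ≡ u + δ v (suc u)
step-up {u} (inj₁ refl) = sym (trans (cong (u +_) (δ-≢ {u} {suc u} (λ u≡1+u → 1+n≢n (sym u≡1+u)))) (+-identityʳ u))
step-up {u} (inj₂ refl) = sym (trans (cong (u +_) (δ-refl (suc u))) (+-comm u 1))

step-flat+up : ∀ {u v} → Step u v → δ v u + δ v (suc u) ≡ 1
step-flat+up {u} (inj₁ refl) = cong₂ _+_ (δ-refl u) (δ-≢ {u} {suc u} (λ u≡1+u → 1+n≢n (sym u≡1+u)))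
step-flat+up {u} (inj₂ refl) = cong₂ _+_ (δ-≢ {suc u} {u} 1+n≢n) (δ-refl (suc u))

step-from : ∀ {u v} → u ≤ v → v ≤ suc u → Step u v
step-from u≤v v≤1+u with m≤n⇒m<n∨m≡n u≤v
... | inj₁ u<v  = inj₂ (≤-antisym v≤1+u u<v)
... | inj₂ refl = inj₁ refl

step-split : ∀ u v (T : ℕ → ℕ) → ⟦ step? u v ⟧ * T v ≡ δ v u * T u + δ v (suc u) * T (suc u)
step-split u v T with v ≟ u | v ≟ suc u
... | yes refl | _ rewrite δ-refl v | δ-≢ {v} {suc v} (λ v≡1+v → 1+n≢n (sym v≡1+v)) = sym (+-identityʳ _)
... | no _ | yes refl rewrite δ-refl u | δ-≢ {suc u} {u} 1+n≢n = refl
... | no v≢u | no v≢1+u rewrite δ-≢ v≢u | δ-≢ v≢1+u = refl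

sumN-neighbours : ∀ N u (T : ℕ → ℕ) →
  sumN N (λ v → ⟦ step? u v ⟧ * T v) ≡ ⟦ u <? N ⟧ * T u + ⟦ suc u <? N ⟧ * T (suc u)
sumN-neighbours N u T =
  trans (sumN-cong N (λ v → step-split u v T))
 (trans (sumN-+ N (λ v → δ v u * T u) (λ v → δ v (suc u) * T (suc u)))
        (cong₂ _+_ (sumN-δ N u (T u)) (sumN-δ N (suc u) (T (suc u)))))

sumL-allVecFun : ∀ k N (G : Fin N → (Fin k → Fin N) → ℕ) →
  sumL (allVecFun (suc k) N) (λ α → G (α fz) (α ∘ fs))
    ≡ sumL (allVecFun k N) (λ g → sumL (allFin N) (λ y → G y g))
sumL-allVecFun k N G =
  trans (sumL-concatMap _ (allVecFun k N) _) (sumL-cong (allVecFun k N) (λ g → sumL-map _ (allFin N) _))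

module Walks (N : ℕ) where

  Walk : ∀ {k} → ℕ → (Fin k → Fin N) → Set
  Walk {zero}  u g = ⊤
  Walk {suc k} u g = Step u (toℕ (g fz)) × Walk (toℕ (g fz)) (g ∘ fs)

  walk? : ∀ {k} u (g : Fin k → Fin N) → Dec (Walk u g)
  walk? {zero}  u g = yes tt
  walk? {suc k} u g = step? u (toℕ (g fz)) ×-dec walk? (toℕ (g fz)) (g ∘ fs)

  flats ups : ∀ {k} → ℕ → (Fin k → Fin N) → ℕ
  flats {zero}  u g = 0
  flats {suc k} u g = δ (toℕ (g fz)) u + flats (toℕ (g fz)) (g ∘ fs)
  ups {zero}  u g = 0
  ups {suc k} u g = δ (toℕ (g fz)) (suc u) + ups (toℕ (g fz)) (g ∘ fs)

  -- The number of fixed points of g when its entry i sits at position s + i.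
  fixes : ∀ {k} → ℕ → (Fin k → Fin N) → ℕ
  fixes {zero}  s g = 0
  fixes {suc k} s g = δ (toℕ (g fz)) s + fixes (suc s) (g ∘ fs)

  flats+ups : ∀ {k} u (g : Fin k → Fin N) → Walk u g → flats u g + ups u g ≡ k
  flats+ups {zero}  u g _ = refl
  flats+ups {suc k} u g (st , w) = begin
    (δ v u + flats v g') + (δ v (suc u) + ups v g')  ≡⟨ interchange (δ v u) _ _ _ ⟩
    (δ v u + δ v (suc u)) + (flats v g' + ups v g')  ≡⟨ cong₂ _+_ (step-flat+up st) (flats+ups v g' w) ⟩
    suc k                                            ∎
    where open ≡-Reasoning; v = toℕ (g fz); g' = g ∘ fs

  walk-bounds : ∀ {k} (α : Fin (suc k) → Fin N) → Walk (toℕ (α fz)) (α ∘ fs) →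
    ∀ x y → toℕ x ≤ toℕ y → toℕ (α x) ≤ toℕ (α y) × toℕ (α y) ≤ toℕ (α x) + (toℕ y ∸ toℕ x)
  walk-bounds α w fz fz _ = ≤-refl , m≤m+n _ 0
  walk-bounds {suc k} α (st , w) fz (fs y) _ =
    let (a₀≤a₁ , a₁≤1+a₀) = step-bounds st
        (a₁≤ay , ay≤a₁+y) = walk-bounds (α ∘ fs) w fz y z≤n
    in ≤-trans a₀≤a₁ a₁≤ay ,
       ≤-trans ay≤a₁+y (≤-trans (+-monoˡ-≤ (toℕ y) a₁≤1+a₀) (≤-reflexive (sym (+-suc (toℕ (α fz)) (toℕ y)))))
  walk-bounds {suc k} α (st , w) (fs x) (fs y) x≤y = walk-bounds (α ∘ fs) w x y (s≤s⁻¹ x≤y)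

  sumL-fixes : ∀ {k} s (g : Fin k → Fin N) (t : Fin k → A) (F : A → ℕ) →
    (∀ i → F (t i) ≡ δ (toℕ (g i)) (s + toℕ i)) → sumL (tabulate t) F ≡ fixes s g
  sumL-fixes {k = zero}  s g t F F≗ = refl
  sumL-fixes {k = suc k} s g t F F≗ = cong₂ _+_
    (trans (F≗ fz) (cong (δ (toℕ (g fz))) (+-identityʳ s)))
    (sumL-fixes (suc s) (g ∘ fs) (t ∘ fs) F (λ i → trans (F≗ (fs i)) (cong (δ (toℕ (g (fs i)))) (+-suc s (toℕ i)))))

  adjacent⇒walk : ∀ {k} (α : Fin (suc k) → Fin N) →
    (∀ x y → toℕ y ≡ suc (toℕ x) → Step (toℕ (α x)) (toℕ (α y))) → Walk (toℕ (α fz)) (α ∘ fs)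
  adjacent⇒walk {zero}  α adj = tt
  adjacent⇒walk {suc k} α adj =
    adj fz (fs fz) refl , adjacent⇒walk (α ∘ fs) (λ x y e → adj (fs x) (fs y) (cong suc e))

  ImageFrom : ∀ {k} → ℕ → (Fin k → Fin N) → ℕ → Set
  ImageFrom u g v = v ≡ u ⊎ ∃ λ i → toℕ (g i) ≡ v

  image⊆range : ∀ {k} u (g : Fin k → Fin N) v → Walk u g → ImageFrom u g v → u ≤ v × v ≤ u + ups u g
  image⊆range u g v w (inj₁ refl) = ≤-refl , m≤m+n u _
  image⊆range {suc k} u g v (st , w) (inj₂ (i , gi≡v)) =
    let (u+d≤v , v≤u+d+ups') = image⊆range (toℕ (g fz)) (g ∘ fs) v w (tail-image i gi≡v)
        u+d≡g₀ = sym (step-up st)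
    in ≤-trans (m≤m+n u _) (subst (_≤ v) (sym u+d≡g₀) u+d≤v) ,
       ≤-trans v≤u+d+ups' (≤-reflexive (trans (cong (_+ ups (toℕ (g fz)) (g ∘ fs)) (sym u+d≡g₀)) (+-assoc u _ _)))
    where
    tail-image : ∀ i → toℕ (g i) ≡ v → ImageFrom (toℕ (g fz)) (g ∘ fs) v
    tail-image fz     e = inj₁ (sym e)
    tail-image (fs i) e = inj₂ (i , e)

  range⊆image : ∀ {k} u (g : Fin k → Fin N) v → Walk u g → u ≤ v → v ≤ u + ups u g → ImageFrom u g v
  range⊆image {zero} u g v w u≤v v≤u+0 = inj₁ (≤-antisym (subst (v ≤_) (+-identityʳ u) v≤u+0) u≤v)
  range⊆image {suc k} u g v (st , w) u≤v v≤u+ups with v ≟ u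
  ... | yes v≡u = inj₁ v≡u
  ... | no  v≢u = lift (range⊆image g₀ (g ∘ fs) v w g₀≤v v≤g₀+ups')
    where
    g₀ = toℕ (g fz)
    d  = δ g₀ (suc u)
    g₀≡u+d = step-up st
    g₀≤v : g₀ ≤ v
    g₀≤v = subst (_≤ v) (sym g₀≡u+d)
             (≤-trans (+-monoʳ-≤ u (δ≤1 g₀ (suc u))) (subst (_≤ v) (+-comm 1 u) (≤∧≢⇒< u≤v (v≢u ∘ sym))))
    v≤g₀+ups' : v ≤ g₀ + ups g₀ (g ∘ fs)
    v≤g₀+ups' = ≤-trans v≤u+ups (≤-reflexive (trans (sym (+-assoc u d _)) (cong (_+ ups g₀ (g ∘ fs)) (sym g₀≡u+d))))
    lift : ImageFrom g₀ (g ∘ fs) v → ImageFrom u g v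
    lift (inj₁ e)       = inj₂ (fz , sym e)
    lift (inj₂ (i , e)) = inj₂ (fs i , e)

  WalkWith : ∀ k (s u z m : ℕ) → (Fin k → Fin N) → Set
  WalkWith k s u z m g = fixes s g ≡ m × flats u g ≡ z × Walk u g

  walkWith? : ∀ k s u z m → Decidable (WalkWith k s u z m)
  walkWith? k s u z m g = (fixes s g ≟ m) ×-dec ((flats u g ≟ z) ×-dec walk? u g)

  walkCount : (k s u z m : ℕ) → ℕ
  walkCount k s u z m = count (walkWith? k s u z m) (allVecFun k N)

  walkCount-empty : ∀ s u z m → walkCount 0 s u z m ≡ W 0 behind z m
  walkCount-empty s u zero    zero    = refl
  walkCount-empty s u (suc z) zero    = cong (_+ 0) (⟦⟧-no (walkWith? 0 s u (suc z) 0 (λ ())) (λ { (_ , () , _) }))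
  walkCount-empty s u z       (suc m) = cong (_+ 0) (⟦⟧-no (walkWith? 0 s u z (suc m) (λ ())) (λ { (() , _) }))

  HeadWalk : ∀ k (s u z m v : ℕ) → (Fin k → Fin N) → Set
  HeadWalk k s u z m v g = δ v s + fixes (suc s) g ≡ m × δ v u + flats v g ≡ z × Step u v × Walk v g

  headWalk? : ∀ k s u z m v → Decidable (HeadWalk k s u z m v)
  headWalk? k s u z m v g =
    (δ v s + fixes (suc s) g ≟ m) ×-dec ((δ v u + flats v g ≟ z) ×-dec (step? u v ×-dec walk? v g))

  count-head : ∀ k s u z m v → count (headWalk? k s u z m v) (allVecFun k N)
    ≡ ⟦ step? u v ⟧ * lower (δ v u) (λ z' → lower (δ v s) (walkCount k (suc s) v z') m) z
  count-head k s u z m v = begin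
    count (headWalk? k s u z m v) gs
      ≡⟨ count-cong (headWalk? k s u z m v) (λ g → step? u v ×-dec flat? g)
           (λ { _ (e₁ , e₂ , st , w) → st , e₂ , e₁ , w }) (λ { _ (st , e₂ , e₁ , w) → e₁ , e₂ , st , w }) gs ⟩
    count (λ g → step? u v ×-dec flat? g) gs
      ≡⟨ count-const× (step? u v) flat? gs ⟩
    ⟦ step? u v ⟧ * count flat? gs
      ≡⟨ cong (⟦ step? u v ⟧ *_) (count-lower (δ v u) z (flats v) fixed? gs) ⟩
    ⟦ step? u v ⟧ * lower (δ v u) (λ z' → count (λ g → (flats v g ≟ z') ×-dec fixed? g) gs) z
      ≡⟨ cong (⟦ step? u v ⟧ *_) (lower-cong (δ v u) z tail-count) ⟩
    ⟦ step? u v ⟧ * lower (δ v u) (λ z' → lower (δ v s) (walkCount k (suc s) v z') m) z ∎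
    where
    open ≡-Reasoning
    gs = allVecFun k N
    fixed? : Decidable (λ g → δ v s + fixes (suc s) g ≡ m × Walk v g)
    fixed? g = (δ v s + fixes (suc s) g ≟ m) ×-dec walk? v g
    flat? : Decidable (λ g → δ v u + flats v g ≡ z × δ v s + fixes (suc s) g ≡ m × Walk v g)
    flat? g = (δ v u + flats v g ≟ z) ×-dec fixed? g
    tail-count : ∀ z' → count (λ g → (flats v g ≟ z') ×-dec fixed? g) gs ≡ lower (δ v s) (walkCount k (suc s) v z') m
    tail-count z' = trans
      (count-cong (λ g → (flats v g ≟ z') ×-dec fixed? g)
                  (λ g → (δ v s + fixes (suc s) g ≟ m) ×-dec ((flats v g ≟ z') ×-dec walk? v g))
                  (λ { _ (e₁ , e₂ , w) → e₂ , e₁ , w }) (λ { _ (e₂ , e₁ , w) → e₁ , e₂ , w }) gs)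
      (count-lower (δ v s) m (fixes (suc s)) (λ g → (flats v g ≟ z') ×-dec walk? v g) gs)

  walkCount-step : ∀ k s u z m → walkCount (suc k) s u z m
    ≡ ⟦ u <? N ⟧ * lower 1 (λ z' → lower (δ u s) (walkCount k (suc s) u z') m) z
    + ⟦ suc u <? N ⟧ * lower (δ (suc u) s) (walkCount k (suc s) (suc u) z) m
  walkCount-step k s u z m = begin
    walkCount (suc k) s u z m
      ≡⟨ sumL-allVecFun k N (λ y g → ⟦ headWalk? k s u z m (toℕ y) g ⟧) ⟩
    sumL (allVecFun k N) (λ g → sumL (allFin N) (λ y → ⟦ headWalk? k s u z m (toℕ y) g ⟧))
      ≡⟨ sumL-comm (allVecFun k N) (allFin N) (λ g y → ⟦ headWalk? k s u z m (toℕ y) g ⟧) ⟩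
    sumL (allFin N) (λ y → count (headWalk? k s u z m (toℕ y)) (allVecFun k N))
      ≡⟨ sumL-allFin N _ (λ v → ⟦ step? u v ⟧ * T v) (λ y → count-head k s u z m (toℕ y)) ⟩
    sumN N (λ v → ⟦ step? u v ⟧ * T v)
      ≡⟨ sumN-neighbours N u T ⟩
    ⟦ u <? N ⟧ * T u + ⟦ suc u <? N ⟧ * T (suc u)
      ≡⟨ cong₂ (λ a b → ⟦ u <? N ⟧ * lower a (λ z' → lower (δ u s) (walkCount k (suc s) u z') m) z
                       + ⟦ suc u <? N ⟧ * lower b (λ z' → lower (δ (suc u) s) (walkCount k (suc s) (suc u) z') m) z)
               (δ-refl u) (δ-≢ {suc u} {u} 1+n≢n) ⟩
    ⟦ u <? N ⟧ * lower 1 (λ z' → lower (δ u s) (walkCount k (suc s) u z') m) z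
      + ⟦ suc u <? N ⟧ * lower (δ (suc u) s) (walkCount k (suc s) (suc u) z) m ∎
    where
    open ≡-Reasoning
    T : ℕ → ℕ
    T v = lower (δ v u) (λ z' → lower (δ v s) (walkCount k (suc s) v z') m) z

  -- For walks whose last entry sits at position N - 1, the count is W.
  walkCount-closed : ∀ k s u z m → s + k ≡ N → u < N → walkCount k s u z m ≡ W k (gap s u) z m
  walkCount-closed zero s u z m s+0≡N u<N =
    trans (walkCount-empty s u z m) (sym (W-below s u (subst (u <_) (trans (sym s+0≡N) (+-identityʳ s)) u<N) z m))
  walkCount-closed (suc k) s u z m s+k+1≡N u<N = begin
    walkCount (suc k) s u z m
      ≡⟨ walkCount-step k s u z m ⟩
    ⟦ u <? N ⟧ * lower 1 (λ z' → lower (δ u s) (walkCount k (suc s) u z') m) z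
      + ⟦ suc u <? N ⟧ * lower (δ (suc u) s) (walkCount k (suc s) (suc u) z) m
      ≡⟨ cong₂ _+_ flat-first up-first ⟩
    lower 1 (λ z' → lower (flatFix (gap s u)) (W k (flatGap (gap s u)) z') m) z
      + lower (upFix (gap s u)) (W k (gap s u) z) m
      ≡⟨ W-step k (gap s u) z m ⟨
    W (suc k) (gap s u) z m ∎
    where
    open ≡-Reasoning
    s+1+k≡N : suc s + k ≡ N
    s+1+k≡N = trans (sym (+-suc s k)) s+k+1≡N
    flat-first : ⟦ u <? N ⟧ * lower 1 (λ z' → lower (δ u s) (walkCount k (suc s) u z') m) z
               ≡ lower 1 (λ z' → lower (flatFix (gap s u)) (W k (flatGap (gap s u)) z') m) z
    flat-first rewrite ⟦⟧-yes (u <? N) u<N | gap-flatFix s u | gap-flatGap s u =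
      trans (*-identityˡ _)
            (lower-cong 1 z (λ z' → lower-cong (δ u s) m (λ m' → walkCount-closed k (suc s) u z' m' s+1+k≡N u<N)))
    up-first : ⟦ suc u <? N ⟧ * lower (δ (suc u) s) (walkCount k (suc s) (suc u) z) m
             ≡ lower (upFix (gap s u)) (W k (gap s u) z) m
    up-first rewrite gap-upFix s u with suc u <? N
    ... | yes 1+u<N =
      trans (*-identityˡ _) (lower-cong (δ (suc u) s) m (λ m' → walkCount-closed k (suc s) (suc u) z m' s+1+k≡N 1+u<N))
    ... | no 1+u≮N = sym (lower-vanish (δ (suc u) s) (W k (gap s u) z) m
                          (λ _ → trans (cong (λ γ → W k γ z (m ∸ δ (suc u) s)) (trans (cong (gap s) u≡s+k) (gap-ahead s k)))
                                       (W-unreachable k z (m ∸ δ (suc u) s))))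
      where
      -- the walk already sits at the top value N - 1
      u≡s+k : u ≡ s + k
      u≡s+k = suc-injective (trans (≤-antisym u<N (≮⇒≥ 1+u≮N)) (trans (sym s+k+1≡N) (+-suc s k)))

dist-≤ : ∀ {a b} → a ≤ b → dist a b ≡ b ∸ a
dist-≤ {a} {b} a≤b = cong (_+ (b ∸ a)) (m≤n⇒m∸n≡0 a≤b)

dist-comm : ∀ a b → dist a b ≡ dist b a
dist-comm a b = +-comm (a ∸ b) (b ∸ a)

module Transformations (k : ℕ) where
  open Walks (suc k)

  oct-adjacent : (α : Transformation (suc k)) → InOCT α →
    ∀ x y → toℕ y ≡ suc (toℕ x) → Step (toℕ (α x)) (toℕ (α y))
  oct-adjacent α (op , ct) x y y≡1+x = step-from αx≤αy αy≤1+αx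
    where
    x≤y : toℕ x ≤ toℕ y
    x≤y = subst (toℕ x ≤_) (sym y≡1+x) (n≤1+n _)
    αx≤αy : toℕ (α x) ≤ toℕ (α y)
    αx≤αy = op x y x≤y
    dist-x-y≡1 : dist (toℕ x) (toℕ y) ≡ 1
    dist-x-y≡1 = trans (dist-≤ x≤y) (trans (cong (_∸ toℕ x) y≡1+x) (m+n∸n≡m 1 (toℕ x)))
    αy∸αx≤1 : toℕ (α y) ∸ toℕ (α x) ≤ 1
    αy∸αx≤1 = subst₂ _≤_ (dist-≤ αx≤αy) dist-x-y≡1 (ct x y)
    αy≤1+αx : toℕ (α y) ≤ suc (toℕ (α x))
    αy≤1+αx = ≤-trans (m≤n+m∸n (toℕ (α y)) (toℕ (α x)))
                      (≤-trans (+-monoʳ-≤ (toℕ (α x)) αy∸αx≤1) (≤-reflexive (+-comm (toℕ (α x)) 1)))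

  oct⇒walk : (α : Transformation (suc k)) → InOCT α → Walk (toℕ (α fz)) (α ∘ fs)
  oct⇒walk α oct = adjacent⇒walk α (oct-adjacent α oct)

  walk⇒oct : (α : Transformation (suc k)) → Walk (toℕ (α fz)) (α ∘ fs) → InOCT α
  walk⇒oct α w = (λ x y x≤y → proj₁ (walk-bounds α w x y x≤y)) , contraction
    where
    ordered : ∀ x y → toℕ x ≤ toℕ y → dist (toℕ (α x)) (toℕ (α y)) ≤ dist (toℕ x) (toℕ y)
    ordered x y x≤y =
      let (αx≤αy , αy≤αx+y∸x) = walk-bounds α w x y x≤y
      in subst₂ _≤_ (sym (dist-≤ αx≤αy)) (sym (dist-≤ x≤y)) (m≤n+o⇒m∸n≤o _ _ αy≤αx+y∸x)
    contraction : Contraction α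
    contraction x y with ≤-total (toℕ x) (toℕ y)
    ... | inj₁ x≤y = ordered x y x≤y
    ... | inj₂ y≤x = subst₂ _≤_ (dist-comm (toℕ (α y)) (toℕ (α x))) (dist-comm (toℕ y) (toℕ x)) (ordered y x y≤x)

  h-walk : (α : Transformation (suc k)) → Walk (toℕ (α fz)) (α ∘ fs) → h α ≡ suc (ups (toℕ (α fz)) (α ∘ fs))
  h-walk α w = begin
    h α
      ≡⟨ count-length (λ y → any? (λ x → α x Fin.≟ y)) (allFin (suc k)) ⟩
    count (λ y → any? (λ x → α x Fin.≟ y)) (allFin (suc k))
      ≡⟨ sumL-allFin (suc k) _ (λ j → ⟦ (a ≤? j) ×-dec (j ≤? a + len) ⟧)
                     (λ y → ⟦⟧-cong (any? (λ x → α x Fin.≟ y)) _ (to y) (from y)) ⟩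
    sumN (suc k) (λ j → ⟦ (a ≤? j) ×-dec (j ≤? a + len) ⟧)
      ≡⟨ sumN-interval (suc k) a len top<1+k ⟩
    suc len ∎
    where
    open ≡-Reasoning
    a = toℕ (α fz)
    len = ups a (α ∘ fs)
    preimage : ∀ {v} → ImageFrom a (α ∘ fs) v → ∃ λ x → toℕ (α x) ≡ v
    preimage (inj₁ e)       = fz , sym e
    preimage (inj₂ (i , e)) = fs i , e
    to : ∀ y → (∃ λ x → α x ≡ y) → a ≤ toℕ y × toℕ y ≤ a + len
    to y (x , αx≡y) = image⊆range a (α ∘ fs) (toℕ y) w (image x αx≡y)
      where
      image : ∀ x → α x ≡ y → ImageFrom a (α ∘ fs) (toℕ y)
      image fz     e = inj₁ (cong toℕ (sym e))
      image (fs i) e = inj₂ (i , cong toℕ e)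
    from : ∀ y → a ≤ toℕ y × toℕ y ≤ a + len → ∃ λ x → α x ≡ y
    from y (a≤y , y≤a+len) =
      let (x , e) = preimage (range⊆image a (α ∘ fs) (toℕ y) w a≤y y≤a+len) in x , toℕ-injective e
    -- the top of the interval is a value of α, hence below k + 1
    top<1+k : a + len < suc k
    top<1+k = let (x , e) = preimage (range⊆image a (α ∘ fs) (a + len) w (m≤m+n a len) ≤-refl)
              in subst (_< suc k) e (toℕ<n (α x))

  f-split : (α : Transformation (suc k)) → f α ≡ δ (toℕ (α fz)) 0 + fixes 1 (α ∘ fs)
  f-split α = trans (count-length (λ x → α x Fin.≟ x) (allFin (suc k)))
                    (sumL-fixes 0 α id (λ x → ⟦ α x Fin.≟ x ⟧) (λ x → ⟦⟧-Fin≡ (α x Fin.≟ x)))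

  Profile : (p' m : ℕ) → Fin (suc k) → (Fin k → Fin (suc k)) → Set
  Profile p' m y g = δ (toℕ y) 0 + fixes 1 g ≡ m × flats (toℕ y) g ≡ k ∸ p' × Walk (toℕ y) g

  profile? : ∀ p' m y → Decidable (Profile p' m y)
  profile? p' m y g = (δ (toℕ y) 0 + fixes 1 g ≟ m) ×-dec ((flats (toℕ y) g ≟ k ∸ p') ×-dec walk? (toℕ y) g)

  oct⇒profile : ∀ p' m (α : Transformation (suc k)) →
    InOCT α × h α ≡ suc p' × f α ≡ m → Profile p' m (α fz) (α ∘ fs)
  oct⇒profile p' m α (oct , hα≡1+p' , fα≡m) = trans (sym (f-split α)) fα≡m , flats≡k∸p' , w
    where
    open ≡-Reasoning
    w = oct⇒walk α oct
    a = toℕ (α fz)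
    g = α ∘ fs
    flats≡k∸p' : flats a g ≡ k ∸ p'
    flats≡k∸p' = begin
      flats a g                      ≡⟨ m+n∸n≡m (flats a g) (ups a g) ⟨
      flats a g + ups a g ∸ ups a g  ≡⟨ cong₂ _∸_ (flats+ups a g w) (suc-injective (trans (sym (h-walk α w)) hα≡1+p')) ⟩
      k ∸ p'                         ∎

  profile⇒oct : ∀ p' m → p' ≤ k → ∀ (α : Transformation (suc k)) →
    Profile p' m (α fz) (α ∘ fs) → InOCT α × h α ≡ suc p' × f α ≡ m
  profile⇒oct p' m p'≤k α (fixed , flats≡k∸p' , w) =
    walk⇒oct α w , trans (h-walk α w) (cong suc ups≡p') , trans (f-split α) fixed
    where
    open ≡-Reasoning
    a = toℕ (α fz)
    g = α ∘ fs
    ups≡p' : ups a g ≡ p'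
    ups≡p' = begin
      ups a g                          ≡⟨ m+n∸m≡n (flats a g) (ups a g) ⟨
      flats a g + ups a g ∸ flats a g  ≡⟨ cong₂ _∸_ (flats+ups a g w) flats≡k∸p' ⟩
      k ∸ (k ∸ p')                     ≡⟨ m∸[m∸n]≡n p'≤k ⟩
      p'                               ∎

  countOCT-by-head : ∀ p' m → p' ≤ k →
    countOCT (suc k) (suc p') m ≡ sumN (suc k) (λ a → lower (δ a 0) (λ m' → W k (gap 1 a) (k ∸ p') m') m)
  countOCT-by-head p' m p'≤k = begin
    countOCT (suc k) (suc p') m
      ≡⟨ trans (count-length _ (allVecFun (suc k) (suc k)))
               (count-cong _ (λ α → profile? p' m (α fz) (α ∘ fs))
                           (oct⇒profile p' m) (profile⇒oct p' m p'≤k) (allVecFun (suc k) (suc k))) ⟩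
    count (λ α → profile? p' m (α fz) (α ∘ fs)) (allVecFun (suc k) (suc k))
      ≡⟨ sumL-allVecFun k (suc k) (λ y g → ⟦ profile? p' m y g ⟧) ⟩
    sumL (allVecFun k (suc k)) (λ g → sumL (allFin (suc k)) (λ y → ⟦ profile? p' m y g ⟧))
      ≡⟨ sumL-comm (allVecFun k (suc k)) (allFin (suc k)) (λ g y → ⟦ profile? p' m y g ⟧) ⟩
    sumL (allFin (suc k)) (λ y → count (profile? p' m y) (allVecFun k (suc k)))
      ≡⟨ sumL-allFin (suc k) _ (λ a → lower (δ a 0) (λ m' → W k (gap 1 a) (k ∸ p') m') m) by-head ⟩
    sumN (suc k) (λ a → lower (δ a 0) (λ m' → W k (gap 1 a) (k ∸ p') m') m) ∎
    where
    open ≡-Reasoning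
    by-head : ∀ y → count (profile? p' m y) (allVecFun k (suc k))
                  ≡ lower (δ (toℕ y) 0) (λ m' → W k (gap 1 (toℕ y)) (k ∸ p') m') m
    by-head y = trans
      (count-lower (δ (toℕ y) 0) m (fixes 1) (λ g → (flats (toℕ y) g ≟ k ∸ p') ×-dec walk? (toℕ y) g) (allVecFun k (suc k)))
      (lower-cong (δ (toℕ y) 0) m (λ m' → walkCount-closed k 1 (toℕ y) (k ∸ p') m' refl (toℕ<n y)))

open import Data.Integer using (+_; -[1+_]; _-_)
import Data.Integer.Properties as ℤ

shifted-diff< : ∀ {j k} → j < k → (+ suc k - + suc j) - + 1 ≡ + (k ∸ suc j)
shifted-diff< {j} {k} j<k = begin
  (+ suc k - + suc j) - + 1  ≡⟨ cong (_- + 1) (trans (ℤ.m-n≡m⊖n (suc k) (suc j)) (ℤ.⊖-≥ (s≤s (<⇒≤ j<k)))) ⟩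
  + (k ∸ j) - + 1            ≡⟨ cong (λ d → + d - + 1) (+-∸-assoc 1 j<k) ⟩
  + (k ∸ suc j)              ∎
  where open ≡-Reasoning

shifted-diff≡ : ∀ k → (+ suc k - + suc k) - + 1 ≡ -[1+ 0 ]
shifted-diff≡ k = cong (_- + 1) (ℤ.+-inverseʳ (+ suc k))

-- p = n: no flat step; the only candidate is the identity, with f = n.
sum-closed-full : ∀ k m' → m' ≤ k →
  W k level (k ∸ k) m' + sumN k (λ j → W k (ahead j) (k ∸ k) (suc m'))
    ≡ (suc (suc k) ∸ suc k) * binomℤ ((+ suc k - + suc m') - + 1) ((+ suc k - + suc k) - + 1)
sum-closed-full k m' m'≤k rewrite n∸n≡0 k | m+n∸n≡m 1 k | shifted-diff≡ k with m≤n⇒m<n∨m≡n m'≤k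
... | inj₁ m'<k rewrite shifted-diff< m'<k | δ-≢ (<⇒≢ m'<k) = sumN-zero k
... | inj₂ refl rewrite shifted-diff≡ m' | δ-refl m' = cong suc (sumN-zero m')

-- p < n: with t + 1 = n - p flat steps, each first value a ≤ t contributes
-- C(n-m-1, t) maps, and the remaining first values none.
sum-closed-< : ∀ k p' m' → m' ≤ p' → p' < k →
  W k level (k ∸ p') m' + sumN k (λ j → W k (ahead j) (k ∸ p') (suc m'))
    ≡ (suc (suc k) ∸ suc p') * binomℤ ((+ suc k - + suc m') - + 1) ((+ suc k - + suc p') - + 1)
sum-closed-< k p' m' m'≤p' p'<k = begin
  W k level (k ∸ p') m' + sumN k (λ j → W k (ahead j) (k ∸ p') (suc m'))
    ≡⟨ cong (λ z → W k level z m' + sumN k (λ j → W k (ahead j) z (suc m'))) k∸p'≡1+t ⟩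
  B k m' t + sumN k (λ j → lower j (λ _ → B k m' t) t)
    ≡⟨ cong (λ r → B k m' t + r) (sumN-lower k t (B k m' t) t<k) ⟩
  suc (suc t) * B k m' t
    ≡⟨ cong₂ _*_ (sym 2+k∸1+p'≡2+t) (B-closed k m' t (≤-<-trans m'≤p' p'<k)) ⟩
  (suc (suc k) ∸ suc p') * ((k ∸ suc m') C t)
    ≡⟨ cong₂ (λ a b → (suc (suc k) ∸ suc p') * binomℤ a b)
             (shifted-diff< (≤-<-trans m'≤p' p'<k)) (shifted-diff< p'<k) ⟨
  (suc (suc k) ∸ suc p') * binomℤ ((+ suc k - + suc m') - + 1) ((+ suc k - + suc p') - + 1) ∎
  where
  open ≡-Reasoning
  t = k ∸ suc p'
  k∸p'≡1+t : k ∸ p' ≡ suc t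
  k∸p'≡1+t = +-∸-assoc 1 p'<k
  t<k : t < k
  t<k = ∸-monoʳ-< z<s p'<k
  2+k∸1+p'≡2+t : suc (suc k) ∸ suc p' ≡ suc (suc t)
  2+k∸1+p'≡2+t = trans (+-∸-assoc 1 (<⇒≤ p'<k)) (cong suc k∸p'≡1+t)

sum-closed : ∀ k p' m' → m' ≤ p' → p' ≤ k →
  W k level (k ∸ p') m' + sumN k (λ j → W k (ahead j) (k ∸ p') (suc m'))
    ≡ (suc (suc k) ∸ suc p') * binomℤ ((+ suc k - + suc m') - + 1) ((+ suc k - + suc p') - + 1)
sum-closed k p' m' m'≤p' p'≤k with m≤n⇒m<n∨m≡n p'≤k
... | inj₁ p'<k = sum-closed-< k p' m' m'≤p' p'<k
... | inj₂ refl = sum-closed-full p' m' m'≤p'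

corollary2p4 : (n p m : ℕ) → 1 ≤ n → 1 ≤ m → m ≤ p → p ≤ n →
    countOCT n p m ≡ (suc n ∸ p) * binomℤ ((+ n - + m) - + 1) ((+ n - + p) - + 1)
corollary2p4 zero    p        m        ()
corollary2p4 (suc k) p        zero     _ ()
corollary2p4 (suc k) zero     (suc m') _ _ ()
corollary2p4 (suc k) (suc p') (suc m') _ _ (s≤s m'≤p') (s≤s p'≤k) = begin
  countOCT (suc k) (suc p') (suc m')
    ≡⟨ Transformations.countOCT-by-head k p' (suc m') p'≤k ⟩
  -- first value 0 gives the level term, first value j + 1 the term ahead j
  W k level (k ∸ p') m' + sumN k (λ j → W k (ahead j) (k ∸ p') (suc m'))
    ≡⟨ sum-closed k p' m' m'≤p' p'≤k ⟩
  (suc (suc k) ∸ suc p') * binomℤ ((+ suc k - + suc m') - + 1) ((+ suc k - + suc p') - + 1) ∎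
  where open ≡-Reasoning
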